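{- Let $T\in\mathscr{T}_{n,k}$ be such that $T':=\operatorname{Proj}(n,T)\in\mathscr{T}_{n-1,k}$ and $T'':=\operatorname{Link}(n,T)\in\mathscr{T}_{n-1,k-1}$. Then $$\nu_{n,k}(T)=\nu_{n-1,k}(T')\,\nu_{n-1,k-1}(T'')\,(1-1/n)^{\binom{n-2}{k}}.$$
   Context: For $m\ge1$, a $j$-face on $[m]$ is a subset of size $j+1$; a simplicial complex on $[m]$ is a nonempty family of subsets closed under taking subsets; $X_j$ is its set of $j$-faces, $K_m^k$ the family of all subsets of $[m]$ of size at most $k+1$, and $\mathscr{C}_{m,k}$ the set of complexes $X$ on $[m]$ with $K_m^{k-1}\subseteq X\subseteq K_m^k$. $\tilde H_j$ is reduced integral homology (with $X_{ -1}=\{\emptyset\}$ in degree $-1$) with rank $\beta_j$. $\mathscr{T}_{m,k}$ is the set of $X\in\mathscr{C}_{m,k}$ with $\beta_k(X)=\beta_{k-1}(X)=0$ and $|X_k|=\binom{m-1}{k}$, and $\nu_{m,k}(T):=|\tilde H_{k-1}(T)|^2/m^{\binom{m-2}{k}}$ is a probability measure on $\mathscr{T}_{m,k}$. For $X\in\mathscr{C}_{n,k}$: $\operatorname{Proj}(n,X)=\{\sigma\in X:n\notin\sigma\}$ and $\operatorname{Link}(n,X)=\{\sigma\subseteq[n-1]:\sigma\cup\{n\}\in X\}$, regarded as complexes on $[n-1]$. -}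

module Defs where

open import Data.Nat as ℕ using (ℕ; zero; suc; _≤_; _∸_; _^_; _≡ᵇ_; _<ᵇ_)
open import Data.Nat.Properties using (m^n≢0)
open import Data.Nat.Combinatorics using (_C_)
open import Data.Integer as ℤ using (ℤ; +_; 0ℤ; 1ℤ; -_)
open import Data.Bool using (Bool; true; false; if_then_else_; _∧_)
open import Data.Fin as Fin using (Fin; zero; suc; toℕ)
open import Data.Fin.Subset using (Subset; _⊆_; ∣_∣; _∪_; ⁅_⁆)
open import Data.Vec using (Vec; []; _∷_; _∷ʳ_; lookup)
open import Data.List using (List; []; _∷_; _++_; map)
open import Data.Product using (Σ; ∃; _×_; _,_)
open import Data.Unit using (⊤)
open import Relation.Binary.PropositionalEquality using (_≡_)
open import Relation.Nullary using (¬_)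
open import Data.Rational as ℚ using (ℚ; 1ℚ)

sumFin : (m : ℕ) → (Fin m → ℤ) → ℤ
sumFin zero    f = 0ℤ
sumFin (suc m) f = f zero ℤ.+ sumFin m (λ i → f (suc i))

countFin : (m : ℕ) → (Fin m → Bool) → ℕ
countFin zero    f = 0
countFin (suc m) f = (if f zero then 1 else 0) ℕ.+ countFin m (λ i → f (suc i))

-- all subsets of [m] (vertex i of [m] is the position i of the Vec)
allSubsets : (m : ℕ) → List (Subset m)
allSubsets zero    = [] ∷ []
allSubsets (suc m) = map (false ∷_) (allSubsets m) ++ map (true ∷_) (allSubsets m)

countList : ∀ {m} → (Subset m → Bool) → List (Subset m) → ℕ
countList p []       = 0
countList p (σ ∷ σs) = (if p σ then 1 else 0) ℕ.+ countList p σs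

Complex : ℕ → Set
Complex m = Subset m → Bool

_∈ᶜ_ : ∀ {m} → Subset m → Complex m → Set
σ ∈ᶜ X = X σ ≡ true

IsSimplicialComplex : ∀ {m} → Complex m → Set
IsSimplicialComplex {m} X =
  (Σ (Subset m) λ σ → σ ∈ᶜ X) × (∀ σ τ → τ ⊆ σ → σ ∈ᶜ X → τ ∈ᶜ X)

-- X ∈ 𝒞_{m,k} :  K_m^{k-1} ⊆ X ⊆ K_m^k   (a j-face has size j+1)
InC : (m k : ℕ) → Complex m → Set
InC m k X = IsSimplicialComplex X
          × (∀ σ → ∣ σ ∣ ≤ k → σ ∈ᶜ X)
          × (∀ σ → σ ∈ᶜ X → ∣ σ ∣ ≤ suc k)

-- |X_j| : number of j-faces (faces of size j+1)
numFaces : ∀ {m} → Complex m → ℕ → ℕ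
numFaces {m} X j = countList (λ σ → X σ ∧ (∣ σ ∣ ≡ᵇ suc j)) (allSubsets m)

-- Augmented integral chain complex. Chains are indexed by the SIZE s of
-- the faces: size s = dimension s-1; size 0 is the empty face (degree -1).

record Chain {m} (X : Complex m) (s : ℕ) : Set where
  field
    c    : Subset m → ℤ
    supp : ∀ σ → ¬ (c σ ≡ 0ℤ) → (σ ∈ᶜ X) × (∣ σ ∣ ≡ s)
open Chain public

sign : ℕ → ℤ
sign zero    = 1ℤ
sign (suc n) = - sign n

below : ∀ {m} → Subset m → Fin m → ℕ
below {m} τ v = countFin m (λ u → lookup τ u ∧ (toℕ u <ᵇ toℕ v))

-- boundary: (∂c)(τ) = Σ_{v ∉ τ} (-1)^{#{u ∈ τ : u < v}} c(τ ∪ {v}),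
-- i.e. the usual alternating-sign simplicial boundary
∂ : ∀ {m} → (Subset m → ℤ) → Subset m → ℤ
∂ {m} c τ = sumFin m (λ v → if lookup τ v then 0ℤ
                             else sign (below τ v) ℤ.* c (τ ∪ ⁅ v ⁆))

IsCycle : ∀ {m} (X : Complex m) (s : ℕ) → Chain X s → Set
IsCycle X zero    z = ⊤
IsCycle X (suc s) z = ∀ τ → ∣ τ ∣ ≡ s → ∂ (c z) τ ≡ 0ℤ

Cycle : ∀ {m} (X : Complex m) (s : ℕ) → Set
Cycle X s = Σ (Chain X s) (IsCycle X s)

IsBoundary : ∀ {m} (X : Complex m) (s : ℕ) → (Subset m → ℤ) → Set
IsBoundary X s f = Σ (Chain X (suc s)) λ d → ∀ τ → ∣ τ ∣ ≡ s → ∂ (c d) τ ≡ f τ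

-- homologous cycles (equality in H̃_{s-1}(X) = Z / B)
Homologous : ∀ {m} (X : Complex m) (s : ℕ) → Cycle X s → Cycle X s → Set
Homologous X s (z , _) (z' , _) = IsBoundary X s (λ σ → c z σ ℤ.- c z' σ)

-- |H̃_{s-1}(X)| = N : the quotient Z/B is in bijection with Fin N
HomologyHasCard : ∀ {m} (X : Complex m) (s : ℕ) → ℕ → Set
HomologyHasCard X s N =
  Σ (Fin N → Cycle X s) λ f →
    (∀ z → Σ (Fin N) λ i → Homologous X s (f i) z)
    × (∀ i j → Homologous X s (f i) (f j) → i ≡ j)

-- β_{s-1}(X) = 0 : H̃_{s-1}(X) has rank 0, i.e. is a torsion group
BettiZero : ∀ {m} (X : Complex m) (s : ℕ) → Set
BettiZero X s = ∀ (z : Cycle X s) →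
  Σ ℕ λ d → (1 ≤ d) × IsBoundary X s (λ σ → + d ℤ.* c (Σ.proj₁ z) σ)

InT : (m k : ℕ) → Complex m → Set
InT m k X = InC m k X
          × BettiZero X (suc k)      -- β_k(X) = 0
          × BettiZero X k            -- β_{k-1}(X) = 0
          × numFaces X k ≡ (m ∸ 1) C k

-- Proj and Link (the vertex n is the last position)

Proj : ∀ {m} → Complex (suc m) → Complex m
Proj X σ = X (σ ∷ʳ false)

Link : ∀ {m} → Complex (suc m) → Complex m
Link X σ = X (σ ∷ʳ true)

-- ν_{m,k}(T) = |H̃_{k-1}(T)|² / m^{C(m-2,k)}, with N = |H̃_{k-1}(T)|

nu : (m k N : ℕ) → .{{_ : ℕ.NonZero m}} → ℚ
nu m k N = (+ (N ℕ.* N) ℚ./ (m ^ ((m ∸ 2) C k))) {{m^n≢0 m ((m ∸ 2) C k)}}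

powℚ : ℚ → ℕ → ℚ
powℚ q zero    = 1ℚ
powℚ q (suc e) = q ℚ.* powℚ q e

-- N = N'·N'', because H̃_{k-1}(T) ≅ H̃_{k-1}(Proj T) × H̃_{k-2}(Link T). A cycle w of
-- Link T is completed to a cycle of T by coning it off, from another vertex, inside Proj T
-- (which contains every face of size k). Conversely a cycle y of T is homologous to such a
-- completion: its link part determines w, and what remains is a cycle of Proj T. The map is
-- injective because H̃_{k-1}(Link T) is torsion and top-dimensional, hence zero. The formula
-- for ν then follows from Pascal's rule C(n-2,k) = C(n-3,k) + C(n-3,k-1).
module Submission where

open import Defs
open import Data.Nat using (ℕ; suc; _∸_)
open import Data.Nat.Combinatorics using (_C_)
open import Relation.Binary.PropositionalEquality using (_≡_)

module Homology where

  open import Data.Bool using (true; false; if_then_else_; _∧_; _∨_)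
  open import Data.Bool.Properties using (∧-zeroʳ)
  open import Data.Empty using (⊥-elim)
  open import Data.Fin using (Fin; zero; suc; inject₁; fromℕ)
  open import Data.Fin.Properties using (injective⇒≤; *↔×)
  open import Data.Fin.Subset using (Subset; ∣_∣; _∪_; ⁅_⁆; ⊥; inside; outside)
  open import Data.Fin.Subset.Properties using (∪-identityʳ)
  open import Data.Integer using (ℤ; +[1+_]; 0ℤ; 1ℤ; -_; _+_; _*_; _-_; _≟_)
  import Data.Integer.Properties as ℤ
  open import Data.Integer.Tactic.RingSolver using (solve-∀)
  open import Data.Nat as ℕ using (ℕ; zero; suc; _≤_)
  import Data.Nat.Properties as ℕ
  open import Data.Product using (∃; _×_; _,_; proj₁; proj₂)
  open import Data.Vec using (Vec; []; _∷_; _∷ʳ_; lookup; init; last; initLast)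
  open import Data.Vec.Properties using (init-∷ʳ; last-∷ʳ)
  open import Function using (_∘_)
  open import Function.Bundles using (Injection)
  open import Function.Properties.Inverse using (↔⇒↣; ↔-sym)
  open import Function.Definitions using (Injective)
  open import Relation.Binary.PropositionalEquality
  open import Relation.Nullary using (¬_; yes; no)

  sumFin-cong : ∀ n {f g : Fin n → ℤ} → (∀ i → f i ≡ g i) → sumFin n f ≡ sumFin n g
  sumFin-cong zero    f≗g = refl
  sumFin-cong (suc n) f≗g = cong₂ _+_ (f≗g zero) (sumFin-cong n (f≗g ∘ suc))

  sumFin-+ : ∀ n (f g : Fin n → ℤ) → sumFin n (λ i → f i + g i) ≡ sumFin n f + sumFin n g
  sumFin-+ zero    f g = refl
  sumFin-+ (suc n) f g rewrite sumFin-+ n (f ∘ suc) (g ∘ suc) =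
    interchange (f zero) (g zero) (sumFin n (f ∘ suc)) (sumFin n (g ∘ suc))
    where
    interchange : ∀ a b c d → a + b + (c + d) ≡ a + c + (b + d)
    interchange = solve-∀

  sumFin-* : ∀ n a (f : Fin n → ℤ) → sumFin n (λ i → a * f i) ≡ a * sumFin n f
  sumFin-* zero    a f = sym (ℤ.*-zeroʳ a)
  sumFin-* (suc n) a f rewrite sumFin-* n a (f ∘ suc) = sym (ℤ.*-distribˡ-+ a (f zero) _)

  sumFin-last : ∀ n (f : Fin (suc n) → ℤ) → sumFin (suc n) f ≡ sumFin n (f ∘ inject₁) + f (fromℕ n)
  sumFin-last zero    f = ℤ.+-comm (f zero) 0ℤ
  sumFin-last (suc n) f rewrite sumFin-last n (f ∘ suc) = sym (ℤ.+-assoc (f zero) _ _)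

  countFin-∧false : ∀ n (p : Fin n → _) → countFin n (λ u → p u ∧ false) ≡ 0
  countFin-∧false zero    p = refl
  countFin-∧false (suc n) p rewrite ∧-zeroʳ (p zero) = countFin-∧false n (p ∘ suc)

  lookup-∷ʳ-inject₁ : ∀ {a} {A : Set a} {n} (xs : Vec A n) x i → lookup (xs ∷ʳ x) (inject₁ i) ≡ lookup xs i
  lookup-∷ʳ-inject₁ (y ∷ xs) x zero    = refl
  lookup-∷ʳ-inject₁ (y ∷ xs) x (suc i) = lookup-∷ʳ-inject₁ xs x i

  lookup-∷ʳ-fromℕ : ∀ {a} {A : Set a} {n} (xs : Vec A n) x → lookup (xs ∷ʳ x) (fromℕ n) ≡ x
  lookup-∷ʳ-fromℕ []       x = refl
  lookup-∷ʳ-fromℕ (y ∷ xs) x = lookup-∷ʳ-fromℕ xs x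

  ∪-∷ʳ : ∀ {n} (σ τ : Subset n) a b → (σ ∷ʳ a) ∪ (τ ∷ʳ b) ≡ (σ ∪ τ) ∷ʳ (a ∨ b)
  ∪-∷ʳ []      []      a b = refl
  ∪-∷ʳ (x ∷ σ) (y ∷ τ) a b = cong ((x ∨ y) ∷_) (∪-∷ʳ σ τ a b)

  ⊥-∷ʳ : ∀ n → ⊥ {suc n} ≡ ⊥ {n} ∷ʳ outside
  ⊥-∷ʳ zero    = refl
  ⊥-∷ʳ (suc n) = cong (outside ∷_) (⊥-∷ʳ n)

  ⁅inject₁⁆ : ∀ {n} (v : Fin n) → ⁅ inject₁ v ⁆ ≡ ⁅ v ⁆ ∷ʳ outside
  ⁅inject₁⁆ {suc n} zero    = cong (inside ∷_) (⊥-∷ʳ n)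
  ⁅inject₁⁆         (suc v) = cong (outside ∷_) (⁅inject₁⁆ v)

  ⁅fromℕ⁆ : ∀ n → ⁅ fromℕ n ⁆ ≡ ⊥ {n} ∷ʳ inside
  ⁅fromℕ⁆ zero    = refl
  ⁅fromℕ⁆ (suc n) = cong (outside ∷_) (⁅fromℕ⁆ n)

  ∣∷ʳoutside∣ : ∀ {n} (σ : Subset n) → ∣ σ ∷ʳ outside ∣ ≡ ∣ σ ∣
  ∣∷ʳoutside∣ []            = refl
  ∣∷ʳoutside∣ (inside  ∷ σ) = cong suc (∣∷ʳoutside∣ σ)
  ∣∷ʳoutside∣ (outside ∷ σ) = ∣∷ʳoutside∣ σ

  ∣∷ʳinside∣ : ∀ {n} (σ : Subset n) → ∣ σ ∷ʳ inside ∣ ≡ suc ∣ σ ∣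
  ∣∷ʳinside∣ []            = refl
  ∣∷ʳinside∣ (inside  ∷ σ) = cong suc (∣∷ʳinside∣ σ)
  ∣∷ʳinside∣ (outside ∷ σ) = ∣∷ʳinside∣ σ

  ∣∷ʳoutside∣≡ : ∀ {n s} (σ : Subset n) → ∣ σ ∷ʳ outside ∣ ≡ s → ∣ σ ∣ ≡ s
  ∣∷ʳoutside∣≡ σ = trans (sym (∣∷ʳoutside∣ σ))

  ∣∷ʳinside∣≡ : ∀ {n s} (σ : Subset n) → ∣ σ ∷ʳ inside ∣ ≡ suc s → ∣ σ ∣ ≡ s
  ∣∷ʳinside∣≡ σ = ℕ.suc-injective ∘ trans (sym (∣∷ʳinside∣ σ))

  below-zero : ∀ {n} (τ : Subset (suc n)) → below τ zero ≡ 0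
  below-zero {n} τ = countFin-∧false (suc n) (lookup τ)

  below-suc : ∀ {n} x (τ : Subset n) v → below (x ∷ τ) (suc v) ≡ (if x then 1 else 0) ℕ.+ below τ v
  below-suc inside  τ v = refl
  below-suc outside τ v = refl

  below-∷ʳ-inject₁ : ∀ {n} (σ : Subset n) x v → below (σ ∷ʳ x) (inject₁ v) ≡ below σ v
  below-∷ʳ-inject₁ (y ∷ σ) x zero    = trans (below-zero ((y ∷ σ) ∷ʳ x)) (sym (below-zero (y ∷ σ)))
  below-∷ʳ-inject₁ (y ∷ σ) x (suc v) = begin
    below (y ∷ (σ ∷ʳ x)) (suc (inject₁ v))        ≡⟨ below-suc y (σ ∷ʳ x) (inject₁ v) ⟩
    (if y then 1 else 0) ℕ.+ below (σ ∷ʳ x) (inject₁ v) ≡⟨ cong (_ ℕ.+_) (below-∷ʳ-inject₁ σ x v) ⟩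
    (if y then 1 else 0) ℕ.+ below σ v              ≡⟨ below-suc y σ v ⟨
    below (y ∷ σ) (suc v)                          ∎
    where open ≡-Reasoning

  below-∷ʳ-fromℕ : ∀ {n} (σ : Subset n) x → below (σ ∷ʳ x) (fromℕ n) ≡ ∣ σ ∣
  below-∷ʳ-fromℕ []            x = below-zero (x ∷ [])
  below-∷ʳ-fromℕ (inside  ∷ σ) x = cong suc (below-∷ʳ-fromℕ σ x)
  below-∷ʳ-fromℕ (outside ∷ σ) x = below-∷ʳ-fromℕ σ x

  sign-square : ∀ n → sign n * sign n ≡ 1ℤ
  sign-square zero    = refl
  sign-square (suc n) = trans (neg-square (sign n)) (sign-square n)
    where
    neg-square : ∀ a → (- a) * (- a) ≡ a * a
    neg-square = solve-∀

  ∂-summand : ∀ {n} → (Subset n → ℤ) → Subset n → Fin n → ℤ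
  ∂-summand f τ v = if lookup τ v then 0ℤ else sign (below τ v) * f (τ ∪ ⁅ v ⁆)

  ∂-cong : ∀ {n} {f g : Subset n → ℤ} → (∀ σ → f σ ≡ g σ) → ∀ τ → ∂ f τ ≡ ∂ g τ
  ∂-cong {n} f≗g τ = sumFin-cong n λ v →
    cong (if lookup τ v then 0ℤ else_) (cong (sign (below τ v) *_) (f≗g (τ ∪ ⁅ v ⁆)))

  ∂-+ : ∀ {n} (f g : Subset n → ℤ) τ → ∂ (λ σ → f σ + g σ) τ ≡ ∂ f τ + ∂ g τ
  ∂-+ {n} f g τ = trans (sumFin-cong n summand-+) (sumFin-+ n (∂-summand f τ) (∂-summand g τ))
    where
    summand-+ : ∀ v → ∂-summand (λ σ → f σ + g σ) τ v ≡ ∂-summand f τ v + ∂-summand g τ v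
    summand-+ v with lookup τ v
    ... | true  = refl
    ... | false = ℤ.*-distribˡ-+ (sign (below τ v)) _ _

  ∂-* : ∀ {n} a (f : Subset n → ℤ) τ → ∂ (λ σ → a * f σ) τ ≡ a * ∂ f τ
  ∂-* {n} a f τ = trans (sumFin-cong n summand-*) (sumFin-* n a (∂-summand f τ))
    where
    commute : ∀ s a x → s * (a * x) ≡ a * (s * x)
    commute = solve-∀
    summand-* : ∀ v → ∂-summand (λ σ → a * f σ) τ v ≡ a * ∂-summand f τ v
    summand-* v with lookup τ v
    ... | true  = sym (ℤ.*-zeroʳ a)
    ... | false = commute (sign (below τ v)) a _

  ∂-- : ∀ {n} (f g : Subset n → ℤ) τ → ∂ (λ σ → f σ - g σ) τ ≡ ∂ f τ - ∂ g τ
  ∂-- f g τ = begin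
    ∂ (λ σ → f σ - g σ) τ          ≡⟨ ∂-cong (λ σ → cong (f σ +_) (ℤ.-1*i≡-i (g σ))) τ ⟨
    ∂ (λ σ → f σ + -1ℤ * g σ) τ    ≡⟨ ∂-+ f (λ σ → -1ℤ * g σ) τ ⟩
    ∂ f τ + ∂ (λ σ → -1ℤ * g σ) τ  ≡⟨ cong (∂ f τ +_) (∂-* -1ℤ g τ) ⟩
    ∂ f τ + -1ℤ * ∂ g τ            ≡⟨ cong (∂ f τ +_) (ℤ.-1*i≡-i (∂ g τ)) ⟩
    ∂ f τ - ∂ g τ                  ∎
    where
    open ≡-Reasoning
    -1ℤ = - 1ℤ

  ∂-zero : ∀ {n} (f : Subset n → ℤ) → (∀ σ → f σ ≡ 0ℤ) → ∀ τ → ∂ f τ ≡ 0ℤ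
  ∂-zero f f≗0 τ =
    trans (∂-cong (λ σ → trans (f≗0 σ) (sym (ℤ.*-zeroˡ (f σ)))) τ) (∂-* 0ℤ f τ)

  projPart linkPart : ∀ {n} → (Subset (suc n) → ℤ) → Subset n → ℤ
  projPart f σ = f (σ ∷ʳ outside)
  linkPart f σ = f (σ ∷ʳ inside)

  ∂-∷ʳ-outside : ∀ {n} (f : Subset (suc n) → ℤ) σ →
                 ∂ f (σ ∷ʳ outside) ≡ ∂ (projPart f) σ + sign ∣ σ ∣ * linkPart f σ
  ∂-∷ʳ-outside {n} f σ =
    trans (sumFin-last n (∂-summand f (σ ∷ʳ outside))) (cong₂ _+_ (sumFin-cong n old) new)
    where
    old : ∀ v → ∂-summand f (σ ∷ʳ outside) (inject₁ v) ≡ ∂-summand (projPart f) σ v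
    old v rewrite lookup-∷ʳ-inject₁ σ outside v | below-∷ʳ-inject₁ σ outside v
                | ⁅inject₁⁆ v | ∪-∷ʳ σ ⁅ v ⁆ outside outside = refl
    new : ∂-summand f (σ ∷ʳ outside) (fromℕ n) ≡ sign ∣ σ ∣ * linkPart f σ
    new rewrite lookup-∷ʳ-fromℕ σ outside | below-∷ʳ-fromℕ σ outside
              | ⁅fromℕ⁆ n | ∪-∷ʳ σ ⊥ outside inside | ∪-identityʳ σ = refl

  ∂-∷ʳ-inside : ∀ {n} (f : Subset (suc n) → ℤ) σ → ∂ f (σ ∷ʳ inside) ≡ ∂ (linkPart f) σ
  ∂-∷ʳ-inside {n} f σ = begin
    ∂ f (σ ∷ʳ inside)
      ≡⟨ sumFin-last n (∂-summand f (σ ∷ʳ inside)) ⟩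
    sumFin n (∂-summand f (σ ∷ʳ inside) ∘ inject₁) + ∂-summand f (σ ∷ʳ inside) (fromℕ n)
      ≡⟨ cong₂ _+_ (sumFin-cong n old) new ⟩
    ∂ (linkPart f) σ + 0ℤ
      ≡⟨ ℤ.+-identityʳ _ ⟩
    ∂ (linkPart f) σ ∎
    where
    open ≡-Reasoning
    old : ∀ v → ∂-summand f (σ ∷ʳ inside) (inject₁ v) ≡ ∂-summand (linkPart f) σ v
    old v rewrite lookup-∷ʳ-inject₁ σ inside v | below-∷ʳ-inject₁ σ inside v
                | ⁅inject₁⁆ v | ∪-∷ʳ σ ⁅ v ⁆ inside outside = refl
    new : ∂-summand f (σ ∷ʳ inside) (fromℕ n) ≡ 0ℤ
    new rewrite lookup-∷ʳ-fromℕ σ inside = refl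

  ∀-∷ʳ : ∀ {n} (P : Subset (suc n) → Set) →
         (∀ σ → P (σ ∷ʳ outside)) → (∀ σ → P (σ ∷ʳ inside)) → ∀ τ → P τ
  ∀-∷ʳ P P-outside P-inside τ with initLast τ
  ... | σ , outside , refl = P-outside σ
  ... | σ , inside  , refl = P-inside σ

  glue : ∀ {n} → (Subset n → ℤ) → (Subset n → ℤ) → Subset (suc n) → ℤ
  glue f g τ = if last τ then g (init τ) else f (init τ)

  glue-outside : ∀ {n} (f g : Subset n → ℤ) σ → glue f g (σ ∷ʳ outside) ≡ f σ
  glue-outside f g σ rewrite last-∷ʳ outside σ | init-∷ʳ outside σ = refl

  glue-inside : ∀ {n} (f g : Subset n → ℤ) σ → glue f g (σ ∷ʳ inside) ≡ g σ
  glue-inside f g σ rewrite last-∷ʳ inside σ | init-∷ʳ inside σ = refl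

  ∂-glue-outside : ∀ {n} (f g : Subset n → ℤ) σ →
                   ∂ (glue f g) (σ ∷ʳ outside) ≡ ∂ f σ + sign ∣ σ ∣ * g σ
  ∂-glue-outside f g σ = trans (∂-∷ʳ-outside (glue f g) σ)
    (cong₂ _+_ (∂-cong (glue-outside f g) σ) (cong (sign ∣ σ ∣ *_) (glue-inside f g σ)))

  ∂-glue-inside : ∀ {n} (f g : Subset n → ℤ) σ → ∂ (glue f g) (σ ∷ʳ inside) ≡ ∂ g σ
  ∂-glue-inside f g σ = trans (∂-∷ʳ-inside (glue f g) σ) (∂-cong (glue-inside f g) σ)

  cone : ∀ {n} → ℕ → (Subset (suc n) → ℤ) → Subset (suc n) → ℤ
  cone j w = glue (λ _ → 0ℤ) (λ ρ → sign j * projPart w ρ)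

  ∂-cone : ∀ {n} j (w : Subset (suc n) → ℤ) → (∀ σ → suc ∣ σ ∣ ≡ j → ∂ w σ ≡ 0ℤ) →
           ∀ τ → ∣ τ ∣ ≡ j → ∂ (cone j w) τ ≡ w τ
  ∂-cone j w w-cycle = ∀-∷ʳ _ base apex
    where
    apex-coefficient : Subset _ → ℤ
    apex-coefficient ρ = sign j * projPart w ρ
    base : ∀ σ → ∣ σ ∷ʳ outside ∣ ≡ j → ∂ (cone j w) (σ ∷ʳ outside) ≡ w (σ ∷ʳ outside)
    base σ |σ|≡j = begin
      ∂ (cone j w) (σ ∷ʳ outside)
        ≡⟨ ∂-glue-outside (λ _ → 0ℤ) apex-coefficient σ ⟩
      ∂ (λ _ → 0ℤ) σ + sign ∣ σ ∣ * (sign j * projPart w σ)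
        ≡⟨ cong₂ (λ a s → a + sign s * (sign j * projPart w σ)) (∂-zero (λ _ → 0ℤ) (λ _ → refl) σ)
                 (∣∷ʳoutside∣≡ σ |σ|≡j) ⟩
      0ℤ + sign j * (sign j * projPart w σ)
        ≡⟨ reassoc (sign j) _ ⟩
      sign j * sign j * projPart w σ
        ≡⟨ cong (_* projPart w σ) (sign-square j) ⟩
      1ℤ * projPart w σ
        ≡⟨ ℤ.*-identityˡ _ ⟩
      w (σ ∷ʳ outside) ∎
      where
      open ≡-Reasoning
      reassoc : ∀ a b → 0ℤ + a * (a * b) ≡ a * a * b
      reassoc = solve-∀
    apex : ∀ σ → ∣ σ ∷ʳ inside ∣ ≡ j → ∂ (cone j w) (σ ∷ʳ inside) ≡ w (σ ∷ʳ inside)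
    apex σ |σ∪n|≡j = begin
      ∂ (cone j w) (σ ∷ʳ inside)            ≡⟨ ∂-glue-inside (λ _ → 0ℤ) apex-coefficient σ ⟩
      ∂ (λ ρ → sign j * projPart w ρ) σ     ≡⟨ ∂-* (sign j) (projPart w) σ ⟩
      sign j * ∂ (projPart w) σ             ≡⟨ cong (λ s → sign s * _) (sym 1+|σ|≡j) ⟩
      - sign ∣ σ ∣ * ∂ (projPart w) σ       ≡⟨ isolate (sign ∣ σ ∣) _ _ (sign-square ∣ σ ∣) w-cycle-at-σ ⟩
      w (σ ∷ʳ inside)                       ∎
      where
      open ≡-Reasoning
      1+|σ|≡j : suc ∣ σ ∣ ≡ j
      1+|σ|≡j = trans (sym (∣∷ʳinside∣ σ)) |σ∪n|≡j
      w-cycle-at-σ : ∂ (projPart w) σ + sign ∣ σ ∣ * linkPart w σ ≡ 0ℤ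
      w-cycle-at-σ = trans (sym (∂-∷ʳ-outside w σ))
                           (w-cycle (σ ∷ʳ outside) (trans (cong suc (∣∷ʳoutside∣ σ)) 1+|σ|≡j))
      isolate : ∀ s x y → s * s ≡ 1ℤ → x + s * y ≡ 0ℤ → - s * x ≡ y
      isolate s x y s²≡1 x+sy≡0 = begin
        - s * x                     ≡⟨ expand s x y ⟩
        - s * (x + s * y) + s * s * y ≡⟨ cong₂ (λ u v → - s * u + v * y) x+sy≡0 s²≡1 ⟩
        - s * 0ℤ + 1ℤ * y           ≡⟨ simplify s y ⟩
        y                           ∎
        where
        expand : ∀ s x y → - s * x ≡ - s * (x + s * y) + s * s * y
        expand = solve-∀
        simplify : ∀ s y → - s * 0ℤ + 1ℤ * y ≡ y
        simplify = solve-∀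

  Homogeneous : ∀ {n} → ℕ → (Subset n → ℤ) → Set
  Homogeneous s f = ∀ σ → ¬ ∣ σ ∣ ≡ s → f σ ≡ 0ℤ

  homogeneous-+ : ∀ {n s} {f g : Subset n → ℤ} →
                  Homogeneous s f → Homogeneous s g → Homogeneous s (λ σ → f σ + g σ)
  homogeneous-+ f-hom g-hom σ |σ|≢s = cong₂ _+_ (f-hom σ |σ|≢s) (g-hom σ |σ|≢s)

  homogeneous-- : ∀ {n s} {f g : Subset n → ℤ} →
                  Homogeneous s f → Homogeneous s g → Homogeneous s (λ σ → f σ - g σ)
  homogeneous-- f-hom g-hom σ |σ|≢s = cong₂ _-_ (f-hom σ |σ|≢s) (g-hom σ |σ|≢s)

  homogeneous-* : ∀ {n s} a {f : Subset n → ℤ} → Homogeneous s f → Homogeneous s (λ σ → a * f σ)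
  homogeneous-* a f-hom σ |σ|≢s = trans (cong (a *_) (f-hom σ |σ|≢s)) (ℤ.*-zeroʳ a)

  projPart-homogeneous : ∀ {n s} {f : Subset (suc n) → ℤ} → Homogeneous s f → Homogeneous s (projPart f)
  projPart-homogeneous f-hom σ |σ|≢s = f-hom (σ ∷ʳ outside) (|σ|≢s ∘ trans (sym (∣∷ʳoutside∣ σ)))

  glue-homogeneous : ∀ {n s} {f g : Subset n → ℤ} →
                     Homogeneous (suc s) f → Homogeneous s g → Homogeneous (suc s) (glue f g)
  glue-homogeneous {f = f} {g} f-hom g-hom = ∀-∷ʳ _
    (λ σ |σ|≢1+s → trans (glue-outside f g σ) (f-hom σ (|σ|≢1+s ∘ trans (∣∷ʳoutside∣ σ))))
    (λ σ |σ|≢1+s → trans (glue-inside f g σ) (g-hom σ (|σ|≢1+s ∘ trans (∣∷ʳinside∣ σ) ∘ cong suc)))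

  cone-homogeneous : ∀ {n j} {w : Subset (suc n) → ℤ} → Homogeneous j w → Homogeneous (suc j) (cone j w)
  cone-homogeneous {j = j} w-hom =
    glue-homogeneous (λ _ _ → refl) (homogeneous-* (sign j) (projPart-homogeneous w-hom))

  module _ {n} {X : Complex n} where

    chain-homogeneous : ∀ {s} (d : Chain X s) → Homogeneous s (c d)
    chain-homogeneous d σ |σ|≢s with c d σ ≟ 0ℤ
    ... | yes dσ≡0 = dσ≡0
    ... | no  dσ≢0 = ⊥-elim (|σ|≢s (proj₂ (supp d σ dσ≢0)))

    fullChain : ∀ {s} → (∀ σ → ∣ σ ∣ ≡ s → σ ∈ᶜ X) → (f : Subset n → ℤ) → Homogeneous s f → Chain X s
    fullChain {s} full f f-hom = record { c = f ; supp = support }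
      where
      support : ∀ σ → ¬ f σ ≡ 0ℤ → σ ∈ᶜ X × ∣ σ ∣ ≡ s
      support σ fσ≢0 with ∣ σ ∣ ℕ.≟ s
      ... | yes |σ|≡s = full σ |σ|≡s , |σ|≡s
      ... | no  |σ|≢s = ⊥-elim (fσ≢0 (f-hom σ |σ|≢s))

    chain-+ : ∀ {s} → Chain X s → Chain X s → Chain X s
    chain-+ d e = record { c = λ σ → c d σ + c e σ ; supp = support }
      where
      support : ∀ σ → ¬ c d σ + c e σ ≡ 0ℤ → _
      support σ sum≢0 with c d σ ≟ 0ℤ
      ... | no  dσ≢0 = supp d σ dσ≢0
      ... | yes dσ≡0 = supp e σ (λ eσ≡0 → sum≢0 (cong₂ _+_ dσ≡0 eσ≡0))

    chain-neg : ∀ {s} → Chain X s → Chain X s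
    chain-neg d = record { c = λ σ → - c d σ ; supp = λ σ -dσ≢0 → supp d σ (λ dσ≡0 → -dσ≢0 (cong -_ dσ≡0)) }

    cycle-∂≡0 : ∀ {s} (z : Cycle X s) → ∀ σ → suc ∣ σ ∣ ≡ s → ∂ (c (proj₁ z)) σ ≡ 0ℤ
    cycle-∂≡0 {suc s} (z , z-cycle) σ 1+|σ|≡1+s = z-cycle σ (ℕ.suc-injective 1+|σ|≡1+s)

    ∂≡0⇒IsCycle : ∀ {s} (z : Chain X s) → (∀ σ → suc ∣ σ ∣ ≡ s → ∂ (c z) σ ≡ 0ℤ) → IsCycle X s z
    ∂≡0⇒IsCycle {zero}  z _    = _
    ∂≡0⇒IsCycle {suc s} z ∂z≡0 = λ σ |σ|≡s → ∂z≡0 σ (cong suc |σ|≡s)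

    mkCycle : ∀ {s} (z : Chain X s) → (∀ σ → suc ∣ σ ∣ ≡ s → ∂ (c z) σ ≡ 0ℤ) → Cycle X s
    mkCycle z ∂z≡0 = z , ∂≡0⇒IsCycle z ∂z≡0

    IsBoundary-cong : ∀ {s} {f g : Subset n → ℤ} → (∀ σ → f σ ≡ g σ) → IsBoundary X s f → IsBoundary X s g
    IsBoundary-cong f≗g (d , ∂d≡f) = d , λ τ |τ|≡s → trans (∂d≡f τ |τ|≡s) (f≗g τ)

    homologous-sym : ∀ {s} (z z' : Cycle X s) → Homologous X s z z' → Homologous X s z' z
    homologous-sym (z , _) (z' , _) (d , ∂d≡z-z') = chain-neg d , λ τ |τ|≡s → begin
      ∂ (λ σ → - c d σ) τ        ≡⟨ ∂-cong (λ σ → ℤ.-1*i≡-i (c d σ)) τ ⟨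
      ∂ (λ σ → - 1ℤ * c d σ) τ   ≡⟨ ∂-* (- 1ℤ) (c d) τ ⟩
      - 1ℤ * ∂ (c d) τ           ≡⟨ cong (- 1ℤ *_) (∂d≡z-z' τ |τ|≡s) ⟩
      - 1ℤ * (c z τ - c z' τ)    ≡⟨ negate (c z τ) (c z' τ) ⟩
      c z' τ - c z τ             ∎
      where
      open ≡-Reasoning
      negate : ∀ a b → - 1ℤ * (a - b) ≡ b - a
      negate = solve-∀

    homologous-trans : ∀ {s} (z₁ z₂ z₃ : Cycle X s) →
                       Homologous X s z₁ z₂ → Homologous X s z₂ z₃ → Homologous X s z₁ z₃
    homologous-trans (z₁ , _) (z₂ , _) (z₃ , _) (d , ∂d≡z₁-z₂) (e , ∂e≡z₂-z₃) =
      chain-+ d e , λ τ |τ|≡s →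
        trans (∂-+ (c d) (c e) τ)
              (trans (cong₂ _+_ (∂d≡z₁-z₂ τ |τ|≡s) (∂e≡z₂-z₃ τ |τ|≡s)) (telescope (c z₁ τ) (c z₂ τ) (c z₃ τ)))
      where
      telescope : ∀ a b c → (a - b) + (b - c) ≡ a - c
      telescope = solve-∀

    chain-above-top≡0 : ∀ {s} → (∀ σ → σ ∈ᶜ X → ∣ σ ∣ ≤ s) → (d : Chain X (suc s)) → ∀ σ → c d σ ≡ 0ℤ
    chain-above-top≡0 bounded d σ with c d σ ≟ 0ℤ
    ... | yes dσ≡0 = dσ≡0
    ... | no  dσ≢0 = let σ∈X , |σ|≡1+s = supp d σ dσ≢0 in
      ⊥-elim (ℕ.<-irrefl refl (subst (_≤ _) |σ|≡1+s (bounded σ σ∈X)))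

    -- With no faces of size s + 1 there are no nonzero boundaries, so a torsion s-cycle is 0.
    topCycle≡0 : ∀ {s} → (∀ σ → σ ∈ᶜ X → ∣ σ ∣ ≤ s) → BettiZero X s → (z : Cycle X s) → ∀ σ → c (proj₁ z) σ ≡ 0ℤ
    topCycle≡0 {s} bounded β≡0 z σ with ∣ σ ∣ ℕ.≟ s | β≡0 z
    ... | no  |σ|≢s | _ = chain-homogeneous (proj₁ z) σ |σ|≢s
    ... | yes |σ|≡s | suc d-1 , _ , D , ∂D≡dz =
      ℤ.*-cancelˡ-≡ +[1+ d-1 ] _ 0ℤ (begin
        +[1+ d-1 ] * c (proj₁ z) σ ≡⟨ ∂D≡dz σ |σ|≡s ⟨
        ∂ (c D) σ                  ≡⟨ ∂-zero (c D) (chain-above-top≡0 bounded D) σ ⟩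
        0ℤ                         ≡⟨ ℤ.*-zeroʳ +[1+ d-1 ] ⟨
        +[1+ d-1 ] * 0ℤ            ∎)
      where open ≡-Reasoning

  module _ {n} {X : Complex (suc n)} where

    projChain : ∀ {s} → Chain X s → Chain (Proj X) s
    projChain d = record
      { c    = projPart (c d)
      ; supp = λ σ dσ≢0 → let σ∈X , |σ|≡s = supp d (σ ∷ʳ outside) dσ≢0 in
                           σ∈X , ∣∷ʳoutside∣≡ σ |σ|≡s }

    linkChain : ∀ {s} → Chain X (suc s) → Chain (Link X) s
    linkChain d = record
      { c    = linkPart (c d)
      ; supp = λ σ dσ≢0 → let σ∈X , |σ|≡s = supp d (σ ∷ʳ inside) dσ≢0 in
                           σ∈X , ∣∷ʳinside∣≡ σ |σ|≡s }

    glueChain : ∀ {s} → Chain (Proj X) (suc s) → Chain (Link X) s → Chain X (suc s)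
    glueChain {s} d e = record { c = glue (c d) (c e) ; supp = ∀-∷ʳ _ support-outside support-inside }
      where
      support-outside : ∀ σ → ¬ glue (c d) (c e) (σ ∷ʳ outside) ≡ 0ℤ → _
      support-outside σ ≢0 = let σ∈X , |σ|≡1+s = supp d σ (≢0 ∘ trans (glue-outside (c d) (c e) σ)) in
        σ∈X , trans (∣∷ʳoutside∣ σ) |σ|≡1+s
      support-inside : ∀ σ → ¬ glue (c d) (c e) (σ ∷ʳ inside) ≡ 0ℤ → _
      support-inside σ ≢0 = let σ∈X , |σ|≡s = supp e σ (≢0 ∘ trans (glue-inside (c d) (c e) σ)) in
        σ∈X , trans (∣∷ʳinside∣ σ) (cong suc |σ|≡s)

    linkCycle : ∀ {s} → Cycle X (suc s) → Cycle (Link X) s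
    linkCycle z = mkCycle (linkChain (proj₁ z)) λ σ 1+|σ|≡s →
      trans (sym (∂-∷ʳ-inside (c (proj₁ z)) σ)) (cycle-∂≡0 z (σ ∷ʳ inside) (trans (cong suc (∣∷ʳinside∣ σ)) (cong suc 1+|σ|≡s)))

    linkBoundary : ∀ {s} {f : Subset (suc n) → ℤ} → IsBoundary X (suc s) f → IsBoundary (Link X) s (linkPart f)
    linkBoundary (d , ∂d≡f) = linkChain d , λ τ |τ|≡s →
      trans (sym (∂-∷ʳ-inside (c d) τ)) (∂d≡f (τ ∷ʳ inside) (trans (∣∷ʳinside∣ τ) (cong suc |τ|≡s)))

  card-× : ∀ {a b c} (Φ : Fin a × Fin b → Fin c) → Injective _≡_ _≡_ Φ → (∀ l → ∃ λ p → Φ p ≡ l) →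
           c ≡ a ℕ.* b
  card-× {a} {b} Φ Φ-injective Φ-surjective = ℕ.≤-antisym
    (injective⇒≤ {f = Injection.to ×↣* ∘ section} λ {l} {l'} eq →
      trans (sym (Φ∘section l)) (trans (cong Φ (Injection.injective ×↣* eq)) (Φ∘section l')))
    (injective⇒≤ {f = Φ ∘ Injection.to *↣×} (Injection.injective *↣× ∘ Φ-injective))
    where
    section = proj₁ ∘ Φ-surjective
    Φ∘section : ∀ l → Φ (section l) ≡ l
    Φ∘section = proj₂ ∘ Φ-surjective
    *↣× = ↔⇒↣ (*↔× {a} {b})
    ×↣* = ↔⇒↣ (↔-sym (*↔× {a} {b}))

  -- H̃_{k-1}(T) ≅ H̃_{k-1}(Proj T) × H̃_{k-2}(Link T)

  module _ {n k} {T : Complex (suc (suc n))} (T∈C : InC (suc (suc n)) (suc k) T)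
           (β-Link≡0 : BettiZero (Link T) (suc k)) where

    private
      K = suc k

      full : ∀ σ → ∣ σ ∣ ≡ K → σ ∈ᶜ T
      full σ |σ|≡K = proj₁ (proj₂ T∈C) σ (ℕ.≤-reflexive |σ|≡K)

      projFull : ∀ σ → ∣ σ ∣ ≡ K → σ ∈ᶜ Proj T
      projFull σ |σ|≡K = full (σ ∷ʳ outside) (trans (∣∷ʳoutside∣ σ) |σ|≡K)

      linkBounded : ∀ σ → σ ∈ᶜ Link T → ∣ σ ∣ ≤ K
      linkBounded σ σ∈L = ℕ.s≤s⁻¹ (subst (_≤ suc K) (∣∷ʳinside∣ σ) (proj₂ (proj₂ T∈C) (σ ∷ʳ inside) σ∈L))

    liftBase : (a w : Subset (suc n) → ℤ) → Subset (suc n) → ℤ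
    liftBase a w σ = a σ - sign k * cone k w σ

    liftᶠ : (a w : Subset (suc n) → ℤ) → Subset (suc (suc n)) → ℤ
    liftᶠ a w = glue (liftBase a w) w

    liftCycle : Cycle (Proj T) K → Cycle (Link T) k → Cycle T K
    liftCycle (a , a-cycle) (w , w-cycle) =
      fullChain full (liftᶠ (c a) (c w))
        (glue-homogeneous (homogeneous-- (chain-homogeneous a)
                             (homogeneous-* (sign k) (cone-homogeneous (chain-homogeneous w))))
                          (chain-homogeneous w))
      , ∀-∷ʳ _ base apex
      where
      ∂w≡0 = cycle-∂≡0 (w , w-cycle)
      base : ∀ σ → ∣ σ ∷ʳ outside ∣ ≡ k → ∂ (liftᶠ (c a) (c w)) (σ ∷ʳ outside) ≡ 0ℤ
      base σ |σ∪n|≡k = begin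
        ∂ (liftᶠ (c a) (c w)) (σ ∷ʳ outside)
          ≡⟨ ∂-glue-outside (liftBase (c a) (c w)) (c w) σ ⟩
        ∂ (liftBase (c a) (c w)) σ + sign ∣ σ ∣ * c w σ
          ≡⟨ cong₂ _+_ (trans (∂-- (c a) (λ ρ → sign k * cone k (c w) ρ) σ)
                              (cong (_-_ (∂ (c a) σ)) (∂-* (sign k) (cone k (c w)) σ)))
                       (cong (λ s → sign s * c w σ) |σ|≡k) ⟩
        ∂ (c a) σ - sign k * ∂ (cone k (c w)) σ + sign k * c w σ
          ≡⟨ cong₂ (λ x y → x - sign k * y + sign k * c w σ)
                   (a-cycle σ |σ|≡k) (∂-cone k (c w) ∂w≡0 σ |σ|≡k) ⟩
        0ℤ - sign k * c w σ + sign k * c w σ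
          ≡⟨ cancel (sign k) (c w σ) ⟩
        0ℤ ∎
        where
        open ≡-Reasoning
        |σ|≡k = ∣∷ʳoutside∣≡ σ |σ∪n|≡k
        cancel : ∀ s x → 0ℤ - s * x + s * x ≡ 0ℤ
        cancel = solve-∀
      apex : ∀ σ → ∣ σ ∷ʳ inside ∣ ≡ k → ∂ (liftᶠ (c a) (c w)) (σ ∷ʳ inside) ≡ 0ℤ
      apex σ |σ∪n|≡k = trans (∂-glue-inside (liftBase (c a) (c w)) (c w) σ)
                             (∂w≡0 σ (trans (sym (∣∷ʳinside∣ σ)) |σ∪n|≡k))

    lift-reflects-link : ∀ a a' w w' → Homologous T K (liftCycle a w) (liftCycle a' w') → Homologous (Link T) k w w'
    lift-reflects-link (a , _) (a' , _) (w , _) (w' , _) lift≈lift' = IsBoundary-cong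
      (λ σ → cong₂ _-_ (glue-inside (liftBase (c a) (c w)) (c w) σ) (glue-inside (liftBase (c a') (c w')) (c w') σ))
      (linkBoundary lift≈lift')

    lift-reflects-proj : ∀ a a' w → Homologous T K (liftCycle a w) (liftCycle a' w) → Homologous (Proj T) K a a'
    lift-reflects-proj (a , _) (a' , _) (w , _) (d , ∂d≡x-x') = projChain d , λ τ |τ|≡K → begin
      ∂ (projPart (c d)) τ
        ≡⟨ isolate (sign ∣ τ ∣) (linkPart-d≡0 τ) ⟩
      ∂ (projPart (c d)) τ + sign ∣ τ ∣ * linkPart (c d) τ
        ≡⟨ ∂-∷ʳ-outside (c d) τ ⟨
      ∂ (c d) (τ ∷ʳ outside)
        ≡⟨ ∂d≡x-x' (τ ∷ʳ outside) (trans (∣∷ʳoutside∣ τ) |τ|≡K) ⟩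
      liftᶠ (c a) (c w) (τ ∷ʳ outside) - liftᶠ (c a') (c w) (τ ∷ʳ outside)
        ≡⟨ cong₂ _-_ (glue-outside (liftBase (c a) (c w)) (c w) τ) (glue-outside (liftBase (c a') (c w)) (c w) τ) ⟩
      (c a τ - sign k * cone k (c w) τ) - (c a' τ - sign k * cone k (c w) τ)
        ≡⟨ cancel (c a τ) (c a' τ) (sign k * cone k (c w) τ) ⟩
      c a τ - c a' τ ∎
      where
      open ≡-Reasoning
      linkPart-d≡0 : ∀ σ → linkPart (c d) σ ≡ 0ℤ
      linkPart-d≡0 = topCycle≡0 linkBounded β-Link≡0 (mkCycle (linkChain d) λ σ 1+|σ|≡K →
        trans (sym (∂-∷ʳ-inside (c d) σ))
              (trans (∂d≡x-x' (σ ∷ʳ inside) (trans (∣∷ʳinside∣ σ) 1+|σ|≡K))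
                     (trans (cong₂ _-_ (glue-inside (liftBase (c a) (c w)) (c w) σ)
                                       (glue-inside (liftBase (c a') (c w)) (c w) σ))
                            (ℤ.+-inverseʳ (c w σ)))))
      isolate : ∀ {x y} s → y ≡ 0ℤ → x ≡ x + s * y
      isolate {x} s refl = sym (trans (cong (_+_ x) (ℤ.*-zeroʳ s)) (ℤ.+-identityʳ x))
      cancel : ∀ a a' c → (a - c) - (a' - c) ≡ a - a'
      cancel = solve-∀

    residualᶠ : (y : Subset (suc (suc n)) → ℤ) (w E : Subset (suc n) → ℤ) → Subset (suc n) → ℤ
    residualᶠ y w E σ = projPart y σ + sign k * cone k w σ - sign k * E σ

    residual : (y : Cycle T K) (w : Cycle (Link T) k) → Homologous (Link T) k w (linkCycle y) → Cycle (Proj T) K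
    residual (y , y-cycle) (w , w-cycle) (E , ∂E≡w-y) =
      fullChain projFull (residualᶠ (c y) (c w) (c E))
        (homogeneous-- (homogeneous-+ (projPart-homogeneous (chain-homogeneous y))
                                      (homogeneous-* (sign k) (cone-homogeneous (chain-homogeneous w))))
                       (homogeneous-* (sign k) (chain-homogeneous E)))
      , λ τ |τ|≡k → begin
        ∂ (residualᶠ (c y) (c w) (c E)) τ
          ≡⟨ ∂-- yCone (λ σ → sign k * c E σ) τ ⟩
        ∂ yCone τ - ∂ (λ σ → sign k * c E σ) τ
          ≡⟨ cong₂ _-_ (trans (∂-+ (projPart (c y)) (λ σ → sign k * cone k (c w) σ) τ)
                              (cong (_+_ (∂ (projPart (c y)) τ)) (∂-* (sign k) (cone k (c w)) τ)))
                       (∂-* (sign k) (c E) τ) ⟩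
        ∂ (projPart (c y)) τ + sign k * ∂ (cone k (c w)) τ - sign k * ∂ (c E) τ
          ≡⟨ cong₂ (λ u v → ∂ (projPart (c y)) τ + sign k * u - sign k * v)
                   (∂-cone k (c w) (cycle-∂≡0 (w , w-cycle)) τ |τ|≡k) (∂E≡w-y τ |τ|≡k) ⟩
        ∂ (projPart (c y)) τ + sign k * c w τ - sign k * (c w τ - linkPart (c y) τ)
          ≡⟨ cancel (∂ (projPart (c y)) τ) (sign k) (c w τ) (linkPart (c y) τ) ⟩
        ∂ (projPart (c y)) τ + sign k * linkPart (c y) τ
          ≡⟨ cong (λ s → ∂ (projPart (c y)) τ + sign s * linkPart (c y) τ) |τ|≡k ⟨
        ∂ (projPart (c y)) τ + sign ∣ τ ∣ * linkPart (c y) τ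
          ≡⟨ ∂-∷ʳ-outside (c y) τ ⟨
        ∂ (c y) (τ ∷ʳ outside)
          ≡⟨ y-cycle (τ ∷ʳ outside) (trans (∣∷ʳoutside∣ τ) |τ|≡k) ⟩
        0ℤ ∎
      where
      open ≡-Reasoning
      yCone : Subset (suc n) → ℤ
      yCone σ = projPart (c y) σ + sign k * cone k (c w) σ
      cancel : ∀ x s v r → x + s * v - s * (v - r) ≡ x + s * r
      cancel = solve-∀

    lift-residual : ∀ y w (w≈y : Homologous (Link T) k w (linkCycle y)) a →
                    Homologous (Proj T) K a (residual y w w≈y) → Homologous T K (liftCycle a w) y
    lift-residual (y , _) (w , _) (E , ∂E≡w-y) (a , _) (G , ∂G≡a-r) = glueChain G E , ∀-∷ʳ _ base apex
      where
      open ≡-Reasoning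
      base : ∀ σ → ∣ σ ∷ʳ outside ∣ ≡ K →
             ∂ (glue (c G) (c E)) (σ ∷ʳ outside) ≡ liftᶠ (c a) (c w) (σ ∷ʳ outside) - c y (σ ∷ʳ outside)
      base σ |σ∪n|≡K = begin
        ∂ (glue (c G) (c E)) (σ ∷ʳ outside)
          ≡⟨ ∂-glue-outside (c G) (c E) σ ⟩
        ∂ (c G) σ + sign ∣ σ ∣ * c E σ
          ≡⟨ cong₂ (λ u s → u + sign s * c E σ) (∂G≡a-r σ |σ|≡K) |σ|≡K ⟩
        (c a σ - residualᶠ (c y) (c w) (c E) σ) + - sign k * c E σ
          ≡⟨ cancel (c a σ) (projPart (c y) σ) (sign k) (cone k (c w) σ) (c E σ) ⟩
        liftBase (c a) (c w) σ - projPart (c y) σ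
          ≡⟨ cong (_- projPart (c y) σ) (glue-outside (liftBase (c a) (c w)) (c w) σ) ⟨
        liftᶠ (c a) (c w) (σ ∷ʳ outside) - c y (σ ∷ʳ outside) ∎
        where
        |σ|≡K = ∣∷ʳoutside∣≡ σ |σ∪n|≡K
        cancel : ∀ a y s C E → a - (y + s * C - s * E) + - s * E ≡ (a - s * C) - y
        cancel = solve-∀
      apex : ∀ σ → ∣ σ ∷ʳ inside ∣ ≡ K →
             ∂ (glue (c G) (c E)) (σ ∷ʳ inside) ≡ liftᶠ (c a) (c w) (σ ∷ʳ inside) - c y (σ ∷ʳ inside)
      apex σ |σ∪n|≡K = begin
        ∂ (glue (c G) (c E)) (σ ∷ʳ inside)
          ≡⟨ ∂-glue-inside (c G) (c E) σ ⟩
        ∂ (c E) σ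
          ≡⟨ ∂E≡w-y σ (∣∷ʳinside∣≡ σ |σ∪n|≡K) ⟩
        c w σ - linkPart (c y) σ
          ≡⟨ cong (_- linkPart (c y) σ) (glue-inside (liftBase (c a) (c w)) (c w) σ) ⟨
        liftᶠ (c a) (c w) (σ ∷ʳ inside) - c y (σ ∷ʳ inside) ∎

    homologyCard-split : ∀ {N N' N''} → HomologyHasCard T K N → HomologyHasCard (Proj T) K N' →
                         HomologyHasCard (Link T) k N'' → N ≡ N' ℕ.* N''
    homologyCard-split (f , classify , separate) (f' , classify' , separate') (f'' , classify'' , separate'') =
      card-× Φ Φ-injective Φ-surjective
      where
      lift : _ → Cycle T K
      lift (i , j) = liftCycle (f' i) (f'' j)
      Φ : _ → _
      Φ p = proj₁ (classify (lift p))
      Φ-homologous : ∀ {p q} → Φ p ≡ Φ q → Homologous T K (lift p) (lift q)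
      Φ-homologous {p} {q} Φp≡Φq = homologous-trans (lift p) (f (Φ q)) (lift q)
        (subst (λ l → Homologous T K (lift p) (f l)) Φp≡Φq
          (homologous-sym (f (Φ p)) (lift p) (proj₂ (classify (lift p)))))
        (proj₂ (classify (lift q)))
      Φ-injective : Injective _≡_ _≡_ Φ
      Φ-injective {i , j} {i' , j'} Φp≡Φq
        with separate'' j j' (lift-reflects-link (f' i) (f' i') (f'' j) (f'' j') (Φ-homologous Φp≡Φq))
      ... | refl = cong (_, j) (separate' i i' (lift-reflects-proj (f' i) (f' i') (f'' j) (Φ-homologous Φp≡Φq)))
      Φ-surjective : ∀ l → ∃ λ p → Φ p ≡ l
      Φ-surjective l = (i , j) , separate (Φ (i , j)) l
        (homologous-trans (f (Φ (i , j))) (lift (i , j)) (f l) (proj₂ (classify (lift (i , j))))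
          (lift-residual (f l) (f'' j) w≈y (f' i) a≈r))
        where
        j = proj₁ (classify'' (linkCycle (f l)))
        w≈y = proj₂ (classify'' (linkCycle (f l)))
        i = proj₁ (classify' (residual (f l) (f'' j) w≈y))
        a≈r = proj₂ (classify' (residual (f l) (f'' j) w≈y))

open Homology using (homologyCard-split)
open import Data.Integer as ℤ using (+_)
import Data.Integer.Properties as ℤ
open import Data.Nat as ℕ using (zero; _^_)
import Data.Nat.Properties as ℕ
open import Data.Nat.Combinatorics using (nCk+nC[k+1]≡[n+1]C[k+1])
open import Data.Nat.Tactic.RingSolver using (solve-∀)
open import Data.Product using (_×_; _,_)
open import Data.Rational using (ℚ; 1ℚ; _-_; _*_; _/_; toℚᵘ)
open import Data.Rational.Properties using (toℚᵘ-injective; toℚᵘ-homo-*; toℚᵘ-homo-+; toℚᵘ-homo‿-; toℚᵘ-fromℚᵘ)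
open import Data.Rational.Unnormalised as ℚᵘ using (ℚᵘ; mkℚᵘ; *≡*; ↥_; ↧_; ↧ₙ_) renaming (_≃_ to _≃ᵘ_)
import Data.Rational.Unnormalised.Properties as ℚᵘ
open import Relation.Binary.PropositionalEquality using (refl; sym; trans; cong; cong₂)

HasFraction : ℚᵘ → ℕ → ℕ → Set
HasFraction p a b = ↥ p ≡ + a × ↧ₙ p ≡ b

fraction-/ : ∀ a b .{{_ : ℕ.NonZero b}} → HasFraction (+ a ℚᵘ./ b) a b
fraction-/ a (suc b) = refl , refl

fraction-* : ∀ {p q a b c d} → HasFraction p a b → HasFraction q c d → HasFraction (p ℚᵘ.* q) (a ℕ.* c) (b ℕ.* d)
fraction-* {mkℚᵘ _ _} {mkℚᵘ _ _} {a} {c = c} (refl , refl) (refl , refl) = sym (ℤ.pos-* a c) , refl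

fraction-≃ : ∀ {p q a b c d} → HasFraction p a b → HasFraction q c d → a ℕ.* d ≡ c ℕ.* b → p ≃ᵘ q
fraction-≃ {mkℚᵘ _ _} {mkℚᵘ _ _} {a} {b} {c} {d} (refl , refl) (refl , refl) ad≡cb =
  *≡* (trans (sym (ℤ.pos-* a d)) (trans (cong +_ ad≡cb) (ℤ.pos-* c b)))

powᵘ : ℚᵘ → ℕ → ℚᵘ
powᵘ q zero    = ℚᵘ.1ℚᵘ
powᵘ q (suc e) = q ℚᵘ.* powᵘ q e

fraction-pow : ∀ {p a b} e → HasFraction p a b → HasFraction (powᵘ p e) (a ^ e) (b ^ e)
fraction-pow         zero    _     = refl , refl
fraction-pow {p} (suc e) p=a/b = fraction-* {p} {powᵘ p e} p=a/b (fraction-pow e p=a/b)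

powᵘ-cong : ∀ {p q} e → p ≃ᵘ q → powᵘ p e ≃ᵘ powᵘ q e
powᵘ-cong         zero    _   = ℚᵘ.≃-refl
powᵘ-cong {p} {q} (suc e) p≃q = ℚᵘ.*-cong {p} {q} {powᵘ p e} {powᵘ q e} p≃q (powᵘ-cong e p≃q)

toℚᵘ-/ : ∀ i d .{{_ : ℕ.NonZero d}} → toℚᵘ (i / d) ≃ᵘ i ℚᵘ./ d
toℚᵘ-/ i (suc d) = toℚᵘ-fromℚᵘ (mkℚᵘ i d)

toℚᵘ-powℚ : ∀ q e → toℚᵘ (powℚ q e) ≃ᵘ powᵘ (toℚᵘ q) e
toℚᵘ-powℚ q zero    = ℚᵘ.≃-refl
toℚᵘ-powℚ q (suc e) = ℚᵘ.≃-trans (toℚᵘ-homo-* q (powℚ q e)) (ℚᵘ.*-congˡ {toℚᵘ q} (toℚᵘ-powℚ q e))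

toℚᵘ-1-1/[2+m] : ∀ m → toℚᵘ (1ℚ - (+ 1 / suc (suc m))) ≃ᵘ + suc m ℚᵘ./ suc (suc m)
toℚᵘ-1-1/[2+m] m = ℚᵘ.≃-trans (toℚᵘ-homo-+ 1ℚ (Data.Rational.- (+ 1 / suc (suc m))))
  (ℚᵘ.≃-trans (ℚᵘ.+-congʳ ℚᵘ.1ℚᵘ (ℚᵘ.≃-trans (toℚᵘ-homo‿- (+ 1 / suc (suc m)))
                                               (ℚᵘ.-‿cong (toℚᵘ-/ (+ 1) (suc (suc m))))))
              (*≡* (cross-multiply m)))
  where
  cross-multiply : ∀ m → ↥ (ℚᵘ.1ℚᵘ ℚᵘ.- (+ 1 ℚᵘ./ suc (suc m))) ℤ.* ↧ (+ suc m ℚᵘ./ suc (suc m))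
                       ≡ ↥ (+ suc m ℚᵘ./ suc (suc m)) ℤ.* ↧ (ℚᵘ.1ℚᵘ ℚᵘ.- (+ 1 ℚᵘ./ suc (suc m)))
  cross-multiply m rewrite ℕ.+-identityʳ m = refl

-- Pascal's rule in the exponent; for m = 0 the truncated m ∸ 1 is harmless as the base is 1.
pascal-^ : ∀ m k → suc m ^ ((m ∸ 1) C suc k) ℕ.* suc m ^ ((m ∸ 1) C k) ≡ suc m ^ (m C suc k)
pascal-^ zero    k = cong₂ ℕ._*_ (ℕ.^-zeroˡ (0 C suc k)) (ℕ.^-zeroˡ (0 C k))
pascal-^ (suc m) k = trans (sym (ℕ.^-distribˡ-+-* (suc (suc m)) (m C suc k) (m C k)))
  (cong (suc (suc m) ^_) (trans (ℕ.+-comm (m C suc k) (m C k)) (nCk+nC[k+1]≡[n+1]C[k+1] m k)))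

nu-product : ∀ m k N N' N'' → N ≡ N' ℕ.* N'' →
  nu (suc (suc m)) (suc k) N
    ≡ nu (suc m) (suc k) N' * nu (suc m) k N'' * powℚ (1ℚ - (+ 1 / suc (suc m))) (m C suc k)
nu-product m k N N' N'' N≡N'N'' = toℚᵘ-injective
  (ℚᵘ.≃-trans lhs≃ (ℚᵘ.≃-trans (fraction-≃ {lhsᵘ} {rhsᵘ} lhs-fraction rhs-fraction cross) (ℚᵘ.≃-sym rhs≃)))
  where
  P = suc (suc m)
  Q = suc m
  e = m C suc k
  e' = (m ∸ 1) C suc k
  e'' = (m ∸ 1) C k
  instance
    P^e≢0 : ℕ.NonZero (P ^ e)
    P^e≢0 = ℕ.m^n≢0 P e
    Q^e'≢0 : ℕ.NonZero (Q ^ e')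
    Q^e'≢0 = ℕ.m^n≢0 Q e'
    Q^e''≢0 : ℕ.NonZero (Q ^ e'')
    Q^e''≢0 = ℕ.m^n≢0 Q e''
  ν' ν'' ratio : ℚᵘ
  ν'    = + (N' ℕ.* N') ℚᵘ./ (Q ^ e')
  ν''   = + (N'' ℕ.* N'') ℚᵘ./ (Q ^ e'')
  ratio = + Q ℚᵘ./ P
  lhsᵘ rhsᵘ : ℚᵘ
  lhsᵘ = + (N ℕ.* N) ℚᵘ./ (P ^ e)
  rhsᵘ = ν' ℚᵘ.* ν'' ℚᵘ.* powᵘ ratio e
  lhs≃ : toℚᵘ (nu P (suc k) N) ≃ᵘ lhsᵘ
  lhs≃ = toℚᵘ-/ (+ (N ℕ.* N)) (P ^ e)
  rhs≃ : toℚᵘ (nu Q (suc k) N' * nu Q k N'' * powℚ (1ℚ - (+ 1 / P)) e) ≃ᵘ rhsᵘ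
  rhs≃ = ℚᵘ.≃-trans (toℚᵘ-homo-* (nu Q (suc k) N' * nu Q k N'') (powℚ (1ℚ - (+ 1 / P)) e))
    (ℚᵘ.*-cong (ℚᵘ.≃-trans (toℚᵘ-homo-* (nu Q (suc k) N') (nu Q k N''))
                           (ℚᵘ.*-cong (toℚᵘ-/ (+ (N' ℕ.* N')) (Q ^ e')) (toℚᵘ-/ (+ (N'' ℕ.* N'')) (Q ^ e''))))
               (ℚᵘ.≃-trans (toℚᵘ-powℚ (1ℚ - (+ 1 / P)) e) (powᵘ-cong e (toℚᵘ-1-1/[2+m] m))))
  lhs-fraction : HasFraction lhsᵘ (N ℕ.* N) (P ^ e)
  lhs-fraction = fraction-/ (N ℕ.* N) (P ^ e)
  rhs-fraction : HasFraction rhsᵘ (N' ℕ.* N' ℕ.* (N'' ℕ.* N'') ℕ.* Q ^ e) (Q ^ e' ℕ.* Q ^ e'' ℕ.* P ^ e)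
  rhs-fraction = fraction-* {ν' ℚᵘ.* ν''} {powᵘ ratio e}
    (fraction-* {ν'} {ν''} (fraction-/ (N' ℕ.* N') (Q ^ e')) (fraction-/ (N'' ℕ.* N'') (Q ^ e'')))
    (fraction-pow {ratio} e (fraction-/ Q P))
  cross : N ℕ.* N ℕ.* (Q ^ e' ℕ.* Q ^ e'' ℕ.* P ^ e) ≡ N' ℕ.* N' ℕ.* (N'' ℕ.* N'') ℕ.* Q ^ e ℕ.* P ^ e
  cross rewrite N≡N'N'' | pascal-^ m k = rearrange N' N'' (Q ^ e) (P ^ e)
    where
    rearrange : ∀ x y u v → x ℕ.* y ℕ.* (x ℕ.* y) ℕ.* (u ℕ.* v) ≡ x ℕ.* x ℕ.* (y ℕ.* y) ℕ.* u ℕ.* v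
    rearrange = solve-∀

corollary3p6 : (m k' : ℕ) (T : Complex (suc (suc m)))
    → InT (suc (suc m)) (suc k') T
    → InT (suc m) (suc k') (Proj T)
    → InT (suc m) k' (Link T)
    → (N N' N'' : ℕ)
    → HomologyHasCard T (suc k') N
    → HomologyHasCard (Proj T) (suc k') N'
    → HomologyHasCard (Link T) k' N''
    → nu (suc (suc m)) (suc k') N
        ≡ nu (suc m) (suc k') N' * nu (suc m) k' N''
          * powℚ (1ℚ - (+ 1 / suc (suc m))) ((suc (suc m) ∸ 2) C suc k')
corollary3p6 m k' T (T∈C , _) _ (_ , β-Link≡0 , _) N N' N'' |H̃T| |H̃Proj| |H̃Link| =
  nu-product m k' N N' N'' (homologyCard-split T∈C β-Link≡0 |H̃T| |H̃Proj| |H̃Link|)
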